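{- Let $G$ be a finite simple graph. Then $G\in\mathcal{F}_2$ and $crx_2(G)=3$ if and only if $G$ is a complete graph on at least $3$ vertices.
   Context: An edge-colouring of $G$ is an arbitrary (not necessarily proper) assignment of colours to the edges of $G$. An edge-coloured cycle is rainbow if all its edges have distinct colours. For $k\geq 1$, $\mathcal{F}_k$ denotes the family of all graphs in which any $k$ vertices lie on a common cycle. For $G\in\mathcal{F}_k$, a $k$-rainbow cycle colouring of $G$ is an edge-colouring such that any $k$ vertices of $G$ lie on a common rainbow cycle of $G$; the $k$-rainbow cycle index $crx_k(G)$ is the minimum number of colours in a $k$-rainbow cycle colouring of $G$ (defined exactly when $G\in\mathcal{F}_k$). -}

module Defs where

open import Data.Nat using (ℕ; zero; suc; _≤_; _<_)
open import Data.Nat.DivMod using (_mod_)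
open import Data.Fin using (Fin; toℕ)
open import Data.Bool using (Bool; true; false)
open import Data.Product using (Σ; ∃; _×_; _,_)
open import Function.Definitions using (Injective)
open import Relation.Binary.PropositionalEquality using (_≡_; _≢_)
open import Relation.Nullary using (¬_)

record SimpleGraph (n : ℕ) : Set where
  field
    adj   : Fin n → Fin n → Bool
    sym   : ∀ u v → adj u v ≡ adj v u
    irrefl : ∀ v → adj v v ≡ false
open SimpleGraph public

Edge : ∀ {n} → SimpleGraph n → Fin n → Fin n → Set
Edge G u v = adj G u v ≡ true

next : ∀ {m} → Fin (suc m) → Fin (suc m)
next {m} i = suc (toℕ i) mod suc m

record Cycle {n : ℕ} (G : SimpleGraph n) : Set where
  field
    len     : ℕ
    len≥3   : 3 ≤ suc len
    vs      : Fin (suc len) → Fin n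
    distinct : Injective _≡_ _≡_ vs
    edges   : ∀ i → Edge G (vs i) (vs (next i))
open Cycle public

OnCycle : ∀ {n} {G : SimpleGraph n} → Fin n → Cycle G → Set
OnCycle v C = ∃ λ i → vs C i ≡ v

InF₂ : ∀ {n} → SimpleGraph n → Set
InF₂ {n} G = ∀ (u v : Fin n) → u ≢ v →
  Σ (Cycle G) λ C → OnCycle u C × OnCycle v C

-- An (arbitrary, not necessarily proper) edge-colouring with colours from Fin k:
-- a colour for every edge, independent of the orientation of the edge.
record EdgeColouring {n : ℕ} (G : SimpleGraph n) (k : ℕ) : Set where
  field
    col    : (u v : Fin n) → Edge G u v → Fin k
    colSym : ∀ u v (p : Edge G u v) (q : Edge G v u) → col u v p ≡ col v u q
open EdgeColouring public

cycleCol : ∀ {n k} {G : SimpleGraph n} → EdgeColouring G k → (C : Cycle G) →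
           Fin (suc (len C)) → Fin k
cycleCol c C i = col c (vs C i) (vs C (next i)) (edges C i)

Rainbow : ∀ {n k} {G : SimpleGraph n} → EdgeColouring G k → Cycle G → Set
Rainbow c C = Injective _≡_ _≡_ (cycleCol c C)

Is2RainbowCycleColouring : ∀ {n k} {G : SimpleGraph n} → EdgeColouring G k → Set
Is2RainbowCycleColouring {n} {G = G} c = ∀ (u v : Fin n) → u ≢ v →
  Σ (Cycle G) λ C → Rainbow c C × OnCycle u C × OnCycle v C

crx₂≡ : ∀ {n} → SimpleGraph n → ℕ → Set
crx₂≡ G k = Σ (EdgeColouring G k) Is2RainbowCycleColouring
          × (∀ j → j < k → ¬ Σ (EdgeColouring G j) Is2RainbowCycleColouring)

IsComplete : ∀ {n} → SimpleGraph n → Set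
IsComplete {n} G = ∀ (u v : Fin n) → u ≢ v → Edge G u v

module Submission where

-- (⇒) A rainbow cycle coloured with three colours has at most three edges,
-- so it is a triangle, and any two distinct vertices of a triangle are
-- adjacent: a 2-rainbow cycle colouring with three colours forces G to be
-- complete.  A cycle has at least three distinct vertices, so a graph in 𝓕₂
-- with two vertices has at least three; a graph with at most one vertex is
-- excluded because the empty colouring is vacuously 2-rainbow, contradicting
-- the minimality of 3.
--
-- (⇐) Every rainbow cycle has at least three colours, which gives the lower
-- bound.  For the upper bound we colour the edge {x, y} (x < y) of the
-- complete graph on ℕ by a function of the residues of x and y modulo 3.
-- A case analysis on the residues of u < v provides a third vertex
-- w, smaller than v or at most 2, such that u v w is a rainbow triangle; for
-- n ≥ 3 this w is a vertex of Kₙ.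

open import Defs
open import Data.Nat using (ℕ; zero; suc; _≤_; _<_; z≤n; s≤s; s≤s⁻¹; _⊓_; _⊔_)
open import Data.Nat.Properties
  using (≤-refl; ≤-trans; <-trans; <⇒≤; <⇒≢; >⇒≢; <⇒≱; ≤∧≢⇒<; <-≤-trans; <-cmp;
         n<1+n; m<n⇒m<1+n; ⊓-comm; ⊔-comm; m≤n⇒m⊓n≡m; m≤n⇒m⊔n≡n)
open import Data.Fin using (Fin; zero; suc; toℕ; fromℕ<)
open import Data.Fin.Properties using (toℕ-fromℕ<; toℕ-injective; injective⇒≤; toℕ<n)
open import Data.Product using (Σ; _×_; _,_; proj₁)
open import Data.Sum using (_⊎_; inj₁; inj₂; [_,_]′)
open import Data.Empty using (⊥-elim)
open import Function.Bundles using (_⇔_; mk⇔)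
open import Function.Definitions using (Injective)
open import Relation.Nullary using (¬_)
open import Relation.Binary using (tri<; tri≈; tri>)
open import Relation.Binary.PropositionalEquality
  using (_≡_; _≢_; refl; cong; subst) renaming (sym to ≡-sym; trans to ≡-trans)

Distinct3 : {A : Set} → A → A → A → Set
Distinct3 x y z = x ≢ y × y ≢ z × z ≢ x

Distinct3-rotate : {A : Set} {x y z : A} → Distinct3 x y z → Distinct3 y z x
Distinct3-rotate (x≢y , y≢z , z≢x) = y≢z , z≢x , x≢y

Distinct3-reverse : {A : Set} {x y z : A} → Distinct3 x y z → Distinct3 z y x
Distinct3-reverse (x≢y , y≢z , z≢x) = (λ e → y≢z (≡-sym e)) , (λ e → x≢y (≡-sym e)) , (λ e → z≢x (≡-sym e))

Distinct3-cong : {A : Set} {x y z x′ y′ z′ : A} →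
  x ≡ x′ → y ≡ y′ → z ≡ z′ → Distinct3 x y z → Distinct3 x′ y′ z′
Distinct3-cong refl refl refl d = d

distinct3⇒injective : {A : Set} (f : Fin 3 → A) →
  Distinct3 (f zero) (f (suc zero)) (f (suc (suc zero))) → Injective _≡_ _≡_ f
distinct3⇒injective f d {zero} {zero} _ = refl
distinct3⇒injective f d {zero} {suc zero} e = ⊥-elim (proj₁ d e)
distinct3⇒injective f (_ , _ , d) {zero} {suc (suc zero)} e = ⊥-elim (d (≡-sym e))
distinct3⇒injective f d {suc zero} {zero} e = ⊥-elim (proj₁ d (≡-sym e))
distinct3⇒injective f d {suc zero} {suc zero} _ = refl
distinct3⇒injective f (_ , d , _) {suc zero} {suc (suc zero)} e = ⊥-elim (d e)
distinct3⇒injective f (_ , _ , d) {suc (suc zero)} {zero} e = ⊥-elim (d e)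
distinct3⇒injective f (_ , d , _) {suc (suc zero)} {suc zero} e = ⊥-elim (d (≡-sym e))
distinct3⇒injective f d {suc (suc zero)} {suc (suc zero)} _ = refl

module _ {n : ℕ} (G : SimpleGraph n) where

  edge-sym : ∀ {u v} → Edge G u v → Edge G v u
  edge-sym {u} {v} e = ≡-trans (sym G v u) e

  no-loop : ∀ {u v} → u ≡ v → ¬ Edge G u v
  no-loop {u} refl e with ≡-trans (≡-sym e) (irrefl G u)
  ... | ()

  cycle⇒order≥3 : Cycle G → 3 ≤ n
  cycle⇒order≥3 C = ≤-trans (len≥3 C) (injective⇒≤ (distinct C))

  rainbow⇒colours≥3 : ∀ {k} (c : EdgeColouring G k) → Is2RainbowCycleColouring c →
    ∀ {u v} → u ≢ v → 3 ≤ k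
  rainbow⇒colours≥3 c rainbow {u} {v} u≢v with rainbow u v u≢v
  ... | C , isRainbow , _ = ≤-trans (len≥3 C) (injective⇒≤ isRainbow)

  empty-colouring : (∀ (u v : Fin n) → u ≡ v) → Σ (EdgeColouring G 0) Is2RainbowCycleColouring
  empty-colouring single =
    record { col = λ u v e → ⊥-elim (no-loop (single u v) e)
           ; colSym = λ u v e _ → ⊥-elim (no-loop (single u v) e) }
    , λ u v u≢v → ⊥-elim (u≢v (single u v))

  triangle-chord : (corner : Fin 3 → Fin n) → (∀ i → Edge G (corner i) (corner (next i))) →
    ∀ i j → i ≢ j → Edge G (corner i) (corner j)
  triangle-chord _ _ zero zero i≢j = ⊥-elim (i≢j refl)
  triangle-chord _ side zero (suc zero) _ = side zero
  triangle-chord _ side zero (suc (suc zero)) _ = edge-sym (side (suc (suc zero)))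
  triangle-chord _ side (suc zero) zero _ = edge-sym (side zero)
  triangle-chord _ _ (suc zero) (suc zero) i≢j = ⊥-elim (i≢j refl)
  triangle-chord _ side (suc zero) (suc (suc zero)) _ = side (suc zero)
  triangle-chord _ side (suc (suc zero)) zero _ = side (suc (suc zero))
  triangle-chord _ side (suc (suc zero)) (suc zero) _ = edge-sym (side (suc zero))
  triangle-chord _ _ (suc (suc zero)) (suc (suc zero)) i≢j = ⊥-elim (i≢j refl)

  short-cycle-chord : ∀ {l} → 3 ≤ suc l → suc l ≤ 3 → (vs : Fin (suc l) → Fin n) →
    (∀ i → Edge G (vs i) (vs (next i))) → ∀ i j → i ≢ j → Edge G (vs i) (vs j)
  short-cycle-chord {zero} (s≤s ()) _
  short-cycle-chord {suc zero} (s≤s (s≤s ())) _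
  short-cycle-chord {suc (suc zero)} _ _ = triangle-chord
  short-cycle-chord {suc (suc (suc _))} _ (s≤s (s≤s (s≤s ())))

  -- A 2-rainbow cycle colouring with three colours puts any two vertices on a
  -- common triangle, hence makes them adjacent.
  three-colours⇒complete : Σ (EdgeColouring G 3) Is2RainbowCycleColouring → IsComplete G
  three-colours⇒complete (c , rainbow) u v u≢v with rainbow u v u≢v
  ... | C , isRainbow , (i , refl) , (j , refl) =
    short-cycle-chord (len≥3 C) (injective⇒≤ isRainbow) (vs C) (edges C) i j
      (λ i≡j → u≢v (cong (vs C) i≡j))

  rainbow-triangle : (complete : IsComplete G) → ∀ {k} (c : EdgeColouring G k) →
    ∀ {a b d} (a≢b : a ≢ b) (b≢d : b ≢ d) (d≢a : d ≢ a) →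
    Distinct3 (col c a b (complete a b a≢b)) (col c b d (complete b d b≢d))
              (col c d a (complete d a d≢a)) →
    Σ (Cycle G) λ C → Rainbow c C × OnCycle a C × OnCycle b C
  rainbow-triangle complete c {a} {b} {d} a≢b b≢d d≢a colours =
    triangle , distinct3⇒injective (cycleCol c triangle) colours , (zero , refl) , (suc zero , refl)
    where
    corner : Fin 3 → Fin n
    corner zero = a
    corner (suc zero) = b
    corner (suc (suc zero)) = d

    side : ∀ i → Edge G (corner i) (corner (next i))
    side zero = complete a b a≢b
    side (suc zero) = complete b d b≢d
    side (suc (suc zero)) = complete d a d≢a

    triangle : Cycle G
    triangle = record { len = 2 ; len≥3 = ≤-refl ; vs = corner
                      ; distinct = distinct3⇒injective corner (a≢b , b≢d , d≢a) ; edges = side }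

order≥3 : ∀ {n} (G : SimpleGraph n) → InF₂ G →
  (∀ j → j < 3 → ¬ Σ (EdgeColouring G j) Is2RainbowCycleColouring) → 3 ≤ n
order≥3 {zero} G _ minimal = ⊥-elim (minimal 0 (s≤s z≤n) (empty-colouring G (λ ())))
order≥3 {suc zero} G _ minimal =
  ⊥-elim (minimal 0 (s≤s z≤n) (empty-colouring G (λ { zero zero → refl })))
order≥3 {suc (suc _)} G inF₂ _ = cycle⇒order≥3 G (proj₁ (inF₂ zero (suc zero) (λ ())))

fewer-than-three-colours-fail : ∀ {n} (G : SimpleGraph n) → 2 ≤ n →
  ∀ j → j < 3 → ¬ Σ (EdgeColouring G j) Is2RainbowCycleColouring
fewer-than-three-colours-fail G (s≤s (s≤s _)) j j<3 (c , rainbow) =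
  <⇒≱ j<3 (rainbow⇒colours≥3 G c rainbow {zero} {suc zero} (λ ()))

rot : Fin 3 → Fin 3
rot zero = suc zero
rot (suc zero) = suc (suc zero)
rot (suc (suc zero)) = zero

rot-injective : ∀ {a b} → rot a ≡ rot b → a ≡ b
rot-injective {zero} {zero} _ = refl
rot-injective {suc zero} {suc zero} _ = refl
rot-injective {suc (suc zero)} {suc (suc zero)} _ = refl
rot-injective {zero} {suc zero} ()
rot-injective {zero} {suc (suc zero)} ()
rot-injective {suc zero} {zero} ()
rot-injective {suc zero} {suc (suc zero)} ()
rot-injective {suc (suc zero)} {zero} ()
rot-injective {suc (suc zero)} {suc zero} ()

-- Residue modulo 3, computed so that res (suc x) reduces to rot (res x).
res : ℕ → Fin 3
res zero = zero
res (suc x) = rot (res x)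

res-pred : ∀ x c → res (suc x) ≡ rot c → res x ≡ c
res-pred _ _ = rot-injective

res≡suc⇒pos : ∀ {x a} → res x ≡ suc a → 0 < x
res≡suc⇒pos {zero} ()
res≡suc⇒pos {suc _} _ = s≤s z≤n

distinct-residues : ∀ {x y a b} → res x ≡ a → res y ≡ b → a ≢ b → x ≢ y
distinct-residues ex ey a≢b refl = a≢b (≡-trans (≡-sym ex) ey)

below-successor : ∀ {x y} → x < suc y → x ≢ y → x < y
below-successor x<1+y = ≤∧≢⇒< (s≤s⁻¹ x<1+y)

residue-colour : Fin 3 → Fin 3 → Fin 3
residue-colour zero b = b
residue-colour (suc zero) zero = suc (suc zero)
residue-colour (suc (suc zero)) zero = suc zero
residue-colour (suc _) (suc _) = zero

colour : ℕ → ℕ → Fin 3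
colour x y = residue-colour (res (x ⊓ y)) (res (x ⊔ y))

colour-sym : ∀ x y → colour x y ≡ colour y x
colour-sym x y rewrite ⊓-comm x y | ⊔-comm x y = refl

colour-≤ : ∀ {x y} → x ≤ y → colour x y ≡ residue-colour (res x) (res y)
colour-≤ x≤y rewrite m≤n⇒m⊓n≡m x≤y | m≤n⇒m⊔n≡n x≤y = refl

RainbowTriangle : ℕ → ℕ → ℕ → Set
RainbowTriangle x y z = Distinct3 (colour x y) (colour y z) (colour z x)

RainbowTriangle-swap : ∀ {x y z} → RainbowTriangle x y z → RainbowTriangle x z y
RainbowTriangle-swap {x} {y} {z} t =
  Distinct3-cong (colour-sym z x) (colour-sym y z) (colour-sym x y) (Distinct3-reverse t)

sorted-rainbow : ∀ {x y z a b c} → res x ≡ a → res y ≡ b → res z ≡ c → x < y → y < z →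
  Distinct3 (residue-colour a b) (residue-colour b c) (residue-colour a c) →
  RainbowTriangle x y z
sorted-rainbow {x} {y} {z} refl refl refl x<y y<z d =
  Distinct3-cong (≡-sym (colour-≤ (<⇒≤ x<y))) (≡-sym (colour-≤ (<⇒≤ y<z)))
    (≡-trans (≡-sym (colour-≤ (<⇒≤ (<-trans x<y y<z)))) (colour-sym x z)) d

-- A third vertex completing u, v to a rainbow triangle; it is smaller than v
-- or at most 2, hence a vertex of every Kₙ containing u, v with n ≥ 3.
record Witness (u v : ℕ) : Set where
  constructor witness
  field
    w       : ℕ
    small   : w < v ⊎ w ≤ 2
    w≢u     : w ≢ u
    w≢v     : w ≢ v
    rainbow : RainbowTriangle u v w

below : ∀ w {u v a b c} → res w ≡ a → res u ≡ b → res v ≡ c → w < u → u < v →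
  Distinct3 (residue-colour a b) (residue-colour b c) (residue-colour a c) → Witness u v
below w ew eu ev w<u u<v d =
  witness w (inj₁ (<-trans w<u u<v)) (<⇒≢ w<u) (<⇒≢ (<-trans w<u u<v))
    (Distinct3-rotate (sorted-rainbow ew eu ev w<u u<v d))

between : ∀ w {u v a b c} → res u ≡ a → res w ≡ b → res v ≡ c → u < w → w < v →
  Distinct3 (residue-colour a b) (residue-colour b c) (residue-colour a c) → Witness u v
between w {u} {v} eu ew ev u<w w<v d =
  witness w (inj₁ w<v) (>⇒≢ u<w) (<⇒≢ w<v) (RainbowTriangle-swap {u} {w} {v} (sorted-rainbow eu ew ev u<w w<v d))

via-zero : ∀ {u v a b} → res u ≡ suc a → res v ≡ b → u < v →
  Distinct3 (suc a) (residue-colour (suc a) b) b → Witness u v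
via-zero eu ev u<v = below 0 refl eu ev (res≡suc⇒pos eu) u<v

via-predecessor : ∀ {u v a c} → res u ≡ a → res v ≡ c → u < suc v → a ≢ c →
  Distinct3 (residue-colour a c) (residue-colour c (rot c)) (residue-colour a (rot c)) →
  Witness u (suc v)
via-predecessor {v = v} eu ev u<1+v a≢c =
  between v eu ev (cong rot ev) (below-successor u<1+v (distinct-residues eu ev a≢c)) (n<1+n _)

-- res u = 0 and res (v + 1) = 1: use 2, or the number two below u.
witness-0-1 : ∀ {u v} → res u ≡ zero → res v ≡ zero → u < suc v → Witness u (suc v)
witness-0-1 {zero} {zero} _ _ _ =
  witness 2 (inj₂ ≤-refl) (λ ()) (λ ()) ((λ ()) , (λ ()) , (λ ()))
witness-0-1 {zero} {suc zero} _ () _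
witness-0-1 {zero} {suc (suc _)} _ ev _ =
  between 2 refl refl (cong rot ev) (s≤s z≤n) (s≤s (s≤s (s≤s z≤n))) ((λ ()) , (λ ()) , (λ ()))
witness-0-1 {suc zero} () _ _
witness-0-1 {suc (suc u)} eu ev u<v =
  below u (res-pred u (suc zero) (res-pred (suc u) (suc (suc zero)) eu)) eu (cong rot ev)
    (m<n⇒m<1+n (n<1+n u)) u<v ((λ ()) , (λ ()) , (λ ()))

-- res u = 2 and res (v + 1) = 2: use v - 1, which has residue 0.
witness-2-2 : ∀ {u v} → res u ≡ suc (suc zero) → res v ≡ suc zero → u < suc v → Witness u (suc v)
witness-2-2 {v = zero} _ () _
witness-2-2 {u} {suc v} eu ev u<2+v =
  between v eu ev₀ (cong rot ev) u<v (m<n⇒m<1+n (n<1+n v)) ((λ ()) , (λ ()) , (λ ()))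
  where
  ev₀ : res v ≡ zero
  ev₀ = res-pred v zero ev

  u<v : u < v
  u<v = below-successor (below-successor u<2+v (distinct-residues eu ev (λ ())))
                        (distinct-residues eu ev₀ (λ ()))

find-witness : ∀ {u v} → u < v → Witness u v
find-witness {u} {suc v} u<v with res u in eu | res v in ev
... | zero           | zero           = witness-0-1 eu ev u<v
... | zero           | suc zero       = via-predecessor eu ev u<v (λ ()) ((λ ()) , (λ ()) , (λ ()))
... | zero           | suc (suc zero) = via-predecessor eu ev u<v (λ ()) ((λ ()) , (λ ()) , (λ ()))
... | suc zero       | zero           = via-predecessor eu ev u<v (λ ()) ((λ ()) , (λ ()) , (λ ()))
... | suc zero       | suc zero       = via-zero eu (cong rot ev) u<v ((λ ()) , (λ ()) , (λ ()))
... | suc zero       | suc (suc zero) = via-zero eu (cong rot ev) u<v ((λ ()) , (λ ()) , (λ ()))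
... | suc (suc zero) | zero           = via-zero eu (cong rot ev) u<v ((λ ()) , (λ ()) , (λ ()))
... | suc (suc zero) | suc zero       = witness-2-2 eu ev u<v
... | suc (suc zero) | suc (suc zero) = via-zero eu (cong rot ev) u<v ((λ ()) , (λ ()) , (λ ()))

module _ {n : ℕ} (G : SimpleGraph n) where

  residue-colouring : EdgeColouring G 3
  residue-colouring = record { col = λ u v _ → colour (toℕ u) (toℕ v)
                             ; colSym = λ u v _ _ → colour-sym (toℕ u) (toℕ v) }

  module _ (complete : IsComplete G) (n≥3 : 3 ≤ n) where

    ordered-pair-on-rainbow-triangle : ∀ u v → toℕ u < toℕ v →
      Σ (Cycle G) λ C → Rainbow residue-colouring C × OnCycle u C × OnCycle v C
    ordered-pair-on-rainbow-triangle u v u<v =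
      rainbow-triangle G complete residue-colouring u≢v v≢w w≢u
        (subst (RainbowTriangle (toℕ u) (toℕ v)) (≡-sym toℕ-w) rainbow)
      where
      open Witness (find-witness u<v) using (w; small; w≢v; rainbow) renaming (w≢u to w≢toℕu)

      w<n : w < n
      w<n = [ (λ w<v → <-trans w<v (toℕ<n v)) , (λ w≤2 → <-≤-trans (s≤s w≤2) n≥3) ]′ small

      toℕ-w : toℕ (fromℕ< w<n) ≡ w
      toℕ-w = toℕ-fromℕ< w<n

      u≢v : u ≢ v
      u≢v u≡v = <⇒≢ u<v (cong toℕ u≡v)

      v≢w : v ≢ fromℕ< w<n
      v≢w v≡w = w≢v (≡-trans (≡-sym toℕ-w) (cong toℕ (≡-sym v≡w)))

      w≢u : fromℕ< w<n ≢ u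
      w≢u w≡u = w≢toℕu (≡-trans (≡-sym toℕ-w) (cong toℕ w≡u))

    residue-colouring-2-rainbow : Is2RainbowCycleColouring residue-colouring
    residue-colouring-2-rainbow u v u≢v with <-cmp (toℕ u) (toℕ v)
    ... | tri< u<v _ _ = ordered-pair-on-rainbow-triangle u v u<v
    ... | tri≈ _ u≡v _ = ⊥-elim (u≢v (toℕ-injective u≡v))
    ... | tri> _ _ v<u with ordered-pair-on-rainbow-triangle v u v<u
    ...   | C , isRainbow , onV , onU = C , isRainbow , onU , onV

theorem3 : ∀ (n : ℕ) (G : SimpleGraph n) →
    (InF₂ G × crx₂≡ G 3) ⇔ (IsComplete G × 3 ≤ n)
theorem3 n G = mk⇔ necessary sufficient
  where
  necessary : InF₂ G × crx₂≡ G 3 → IsComplete G × 3 ≤ n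
  necessary (inF₂ , threeColours , minimal) =
    three-colours⇒complete G threeColours , order≥3 G inF₂ minimal

  sufficient : IsComplete G × 3 ≤ n → InF₂ G × crx₂≡ G 3
  sufficient (complete , n≥3) =
    (λ u v u≢v → let (C , _ , onU , onV) = rainbowColouring u v u≢v in C , onU , onV)
    , (residue-colouring G , rainbowColouring)
    , fewer-than-three-colours-fail G (<⇒≤ n≥3)
    where
    rainbowColouring : Is2RainbowCycleColouring (residue-colouring G)
    rainbowColouring = residue-colouring-2-rainbow G complete n≥3
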